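{- Let $\mathcal{C}$ be the class of finite simple connected planar graphs (given with a plane embedding) whose dual graph is also a simple connected planar graph. Taking the dual does not preserve twin-width: there exists $G\in\mathcal{C}$ such that $\mathrm{tww}(G)\neq \mathrm{tww}(G^*)$, where $G^*$ is the dual graph of $G$.
   Context: The dual graph $G^*$ of a plane graph $G$ has one vertex for each face of $G$, and an edge for each edge of $G$ joining the (vertices corresponding to the) two faces on either side of that edge (a loop if the same face lies on both sides). Twin-width: a trigraph is a vertex set with two disjoint sets of edges, black and red. Contracting two distinct vertices $u,v$ replaces them by a new vertex $w$; each $x\ne u,v$ adjacent to exactly one of $u,v$ is joined to $w$ by a red edge; each $x$ adjacent to both is joined to $w$ by a black edge if $ux,vx$ are both black and by a red edge otherwise; other edges are unchanged. A simple graph is a trigraph with no red edges. A $d$-sequence for an $n$-vertex graph $G$ is a sequence $G=G_n,\dots,G_1$ of trigraphs, each obtained from the previous by one contraction, with every vertex of every $G_i$ incident to at most $d$ red edges; $\mathrm{tww}(G)$ is the least such $d$. -}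

module Defs where

open import Data.Nat using (ℕ; zero; suc; _+_; _*_; _≤_)
open import Data.Fin using (Fin)
open import Data.List using (List; map; allFin)
open import Data.Nat.ListAction using (sum)
open import Data.Product using (Σ; ∃; _×_; _,_)
open import Data.Sum using (_⊎_)
open import Relation.Nullary using (¬_)
open import Relation.Binary.PropositionalEquality using (_≡_; _≢_)
open import Function using (_∘_)

data Col : Set where
  none black red : Col

-- colour of the edge w x after contracting u,v into w, given the colours
-- of u x and v x
comb : Col → Col → Col
comb none  none  = none
comb black black = black
comb _     _     = red

record Trigraph (k : ℕ) : Set where
  field
    E   : Fin k → Fin k → Col
    sym : ∀ x y → E x y ≡ E y x
    irr : ∀ x → E x x ≡ none
open Trigraph public

isRed : Col → ℕ
isRed red = 1
isRed _   = 0

redDeg : ∀ {k} → Trigraph k → Fin k → ℕ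
redDeg {k} T x = sum (map (λ y → isRed (E T x y)) (allFin k))

RedBounded : ∀ {k} → ℕ → Trigraph k → Set
RedBounded {k} d T = ∀ (x : Fin k) → redDeg T x ≤ d

-- T' is obtained from T by contracting two distinct vertices u, v.
-- The vertices of T' are named via q : the new vertex w is q u = q v,
-- and every other vertex x of T is renamed q x.
Step : ∀ {k} → Trigraph (suc k) → Trigraph k → Set
Step {k} T T' =
  Σ (Fin (suc k)) λ u → Σ (Fin (suc k)) λ v → Σ (Fin (suc k) → Fin k) λ q →
    u ≢ v × q u ≡ q v
    × (∀ x y → ¬ (x ≡ u ⊎ x ≡ v) → q x ≡ q y → x ≡ y)
    × (∀ x y → ¬ (x ≡ u ⊎ x ≡ v) → ¬ (y ≡ u ⊎ y ≡ v) →
         E T' (q x) (q y) ≡ E T x y)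
    × (∀ x → ¬ (x ≡ u ⊎ x ≡ v) →
         E T' (q u) (q x) ≡ comb (E T u x) (E T v x))

data Seq (d : ℕ) : (k : ℕ) → Trigraph k → Set where
  last : (T : Trigraph 1) → RedBounded d T → Seq d 1 T
  step : ∀ {k} (T : Trigraph (suc k)) (T' : Trigraph k) →
         RedBounded d T → Step T T' → Seq d k T' → Seq d (suc k) T

Represents : ∀ {n} → Trigraph n → (Fin n → Fin n → Set) → Set
Represents {n} T Adj = ∀ (u v : Fin n) →
  ((E T u v ≡ black → Adj u v) × (Adj u v → E T u v ≡ black)) × E T u v ≢ red

HasDSeq : ℕ → (n : ℕ) → (Fin n → Fin n → Set) → Set
HasDSeq d n Adj = Σ (Trigraph n) λ T → Represents T Adj × Seq d n T

TwinWidth : (n : ℕ) → (Fin n → Fin n → Set) → ℕ → Set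
TwinWidth n Adj t = HasDSeq t n Adj × (∀ d → HasDSeq d n Adj → t ≤ d)

iter : ∀ {A : Set} → (A → A) → ℕ → A → A
iter f zero    x = x
iter f (suc k) x = f (iter f k x)

SameOrbit : ∀ {A : Set} → (A → A) → A → A → Set
SameOrbit f x y = ∃ λ k → iter f k x ≡ y

data Reach {A : Set} (σ α : A → A) (x : A) : A → Set where
  here  : Reach σ α x x
  viaσ  : ∀ {y} → Reach σ α x y → Reach σ α x (σ y)
  viaα  : ∀ {y} → Reach σ α x y → Reach σ α x (α y)

-- A connected plane graph with d darts (d/2 edges), n vertices, f faces.
-- α : the dart involution (the two halves of each edge),
-- σ : the rotation (cyclic order of darts around each vertex),
-- vertices = σ-orbits (labelled by vert), faces = (σ ∘ α)-orbits
-- (labelled by face).  Genus 0 (planarity of the embedding) is Euler's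
-- formula n - d/2 + f = 2.
record PlaneMap : Set where
  field
    d n f   : ℕ
    α σ σ⁻¹ : Fin d → Fin d
    α-invol : ∀ x → α (α x) ≡ x
    α-nofix : ∀ x → α x ≢ x
    σ-left  : ∀ x → σ⁻¹ (σ x) ≡ x
    σ-right : ∀ x → σ (σ⁻¹ x) ≡ x
    vert      : Fin d → Fin n
    vert-surj : ∀ v → ∃ λ x → vert x ≡ v
    vert-orb  : ∀ x y → (vert x ≡ vert y → SameOrbit σ x y)
                      × (SameOrbit σ x y → vert x ≡ vert y)
    face      : Fin d → Fin f
    face-surj : ∀ a → ∃ λ x → face x ≡ a
    face-orb  : ∀ x y → (face x ≡ face y → SameOrbit (σ ∘ α) x y)
                      × (SameOrbit (σ ∘ α) x y → face x ≡ face y)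
    connected : ∀ x y → Reach σ α x y
    euler     : 2 * (n + f) ≡ 4 + d
open PlaneMap public

Adj : (M : PlaneMap) → Fin (n M) → Fin (n M) → Set
Adj M u v = ∃ λ x → vert M x ≡ u × vert M (α M x) ≡ v

-- the dual graph G* : an edge between the faces on either side of each edge
DualAdj : (M : PlaneMap) → Fin (f M) → Fin (f M) → Set
DualAdj M a b = ∃ λ x → face M x ≡ a × face M (α M x) ≡ b

GraphSimple : PlaneMap → Set
GraphSimple M = (∀ x → vert M (α M x) ≢ vert M x)
  × (∀ x y → vert M x ≡ vert M y → vert M (α M x) ≡ vert M (α M y) → x ≡ y)

DualSimple : PlaneMap → Set
DualSimple M = (∀ x → face M (α M x) ≢ face M x)
  × (∀ x y → face M x ≡ face M y → face M (α M x) ≡ face M (α M y) → x ≡ y)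

{-# OPTIONS --safe #-}
module Submission where

-- The witness is the triangular prism, of twin-width 2, whose dual K₅ − e has twin-width 0.
-- In the prism any two vertices are distinguished by two further vertices, so the very first
-- contraction of any sequence creates a vertex of red degree 2; an explicit 2-sequence gives
-- the upper bound. In K₅ − e the two non-adjacent vertices are twins, and contracting them
-- leaves K₄, which is contracted twin by twin without ever creating a red edge.

open import Defs
open import Data.Nat using (ℕ; zero; suc; _+_; _≤_; _≤?_; z≤n)
open import Data.Nat.Properties using (≤-trans; m≤m+n; m≤n+m; +-monoʳ-≤; +-comm)
open import Data.Nat.ListAction using (sum)
open import Data.Fin using (Fin; zero; suc; #_; toℕ; _≟_)
open import Data.Fin.Properties using (all?; any?)
open import Data.Vec using (Vec; lookup; []; _∷_)
open import Data.List using (List; tabulate; map; []; _∷_; _++_)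
open import Data.List.Properties using (map-tabulate)
import Data.List.Relation.Unary.Any as Any
open import Data.Bool using (Bool; true; false)
open import Data.Product using (Σ; ∃; _×_; _,_; proj₁; proj₂)
open import Data.Sum using (_⊎_; inj₁; inj₂)
open import Data.Empty using (⊥-elim)
open import Function using (_∘_; id)
open import Relation.Nullary using (¬_; Dec; yes; no)
open import Relation.Nullary.Decidable
  using (True; toWitness; from-yes; ¬?; _×-dec_; _⊎-dec_; _→-dec_)
open import Relation.Binary.PropositionalEquality
  using (_≡_; _≢_; refl; trans; cong; cong₂; subst; subst₂)
  renaming (sym to ≡-sym)

_≟ᶜ_ : (a b : Col) → Dec (a ≡ b)
none  ≟ᶜ none  = yes refl
black ≟ᶜ black = yes refl
red   ≟ᶜ red   = yes refl
none  ≟ᶜ black = no λ ()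
none  ≟ᶜ red   = no λ ()
black ≟ᶜ none  = no λ ()
black ≟ᶜ red   = no λ ()
red   ≟ᶜ none  = no λ ()
red   ≟ᶜ black = no λ ()

fromTable : ∀ {k} (t : Vec (Vec Col k) k) →
  {_ : True (all? λ x → all? λ y → lookup (lookup t x) y ≟ᶜ lookup (lookup t y) x)} →
  {_ : True (all? λ x → lookup (lookup t x) x ≟ᶜ none)} → Trigraph k
fromTable t {s} {i} = record
  { E = λ x y → lookup (lookup t x) y ; sym = toWitness s ; irr = toWitness i }

edgeColour : ∀ {P : Set} → Dec P → Col
edgeColour (yes _) = black
edgeColour (no _)  = none

simpleTrigraph : ∀ {n} {A : Fin n → Fin n → Set} → (∀ u v → Dec (A u v)) →
  (∀ {u v} → A u v → A v u) → (∀ u → ¬ A u u) → Trigraph n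
simpleTrigraph {A = A} A? A-sym A-irrefl = record
  { E = λ u v → edgeColour (A? u v) ; sym = colour-sym ; irr = colour-irrefl }
  where
  colour-sym : ∀ u v → edgeColour (A? u v) ≡ edgeColour (A? v u)
  colour-sym u v with A? u v | A? v u
  ... | yes _  | yes _  = refl
  ... | no _   | no _   = refl
  ... | yes a  | no ¬a  = ⊥-elim (¬a (A-sym a))
  ... | no ¬a  | yes a  = ⊥-elim (¬a (A-sym a))
  colour-irrefl : ∀ u → edgeColour (A? u u) ≡ none
  colour-irrefl u with A? u u
  ... | yes a = ⊥-elim (A-irrefl u a)
  ... | no _  = refl

simpleTrigraph-represents : ∀ {n} {A : Fin n → Fin n → Set} (A? : ∀ u v → Dec (A u v))
  (A-sym : ∀ {u v} → A u v → A v u) (A-irrefl : ∀ u → ¬ A u u) →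
  Represents (simpleTrigraph A? A-sym A-irrefl) A
simpleTrigraph-represents A? _ _ u v = edgeColour-represents (A? u v)
  where
  edgeColour-represents : ∀ {P : Set} (p? : Dec P) →
    ((edgeColour p? ≡ black → P) × (P → edgeColour p? ≡ black)) × edgeColour p? ≢ red
  edgeColour-represents (yes p) = ((λ _ → p) , λ _ → refl) , λ ()
  edgeColour-represents (no ¬p) = ((λ ()) , λ p → ⊥-elim (¬p p)) , λ ()

module _ {n} {T : Trigraph n} {A : Fin n → Fin n → Set} (rep : Represents T A) where

  represents-edge : ∀ {u v} → A u v → E T u v ≡ black
  represents-edge {u} {v} = proj₂ (proj₁ (rep u v))

  represents-nonEdge : ∀ {u v} → ¬ A u v → E T u v ≡ none
  represents-nonEdge {u} {v} ¬a with E T u v | rep u v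
  ... | none  | _             = refl
  ... | black | (b⇒a , _) , _ = ⊥-elim (¬a (b⇒a refl))
  ... | red   | _ , ¬red      = ⊥-elim (¬red refl)

redBounded? : ∀ {k} d (T : Trigraph k) → Dec (RedBounded d T)
redBounded? d T = all? λ x → redDeg T x ≤? d

Outside : ∀ {k} → Fin k → Fin k → Fin k → Set
Outside u v x = ¬ (x ≡ u ⊎ x ≡ v)

outside? : ∀ {k} (u v x : Fin k) → Dec (Outside u v x)
outside? u v x = ¬? ((x ≟ u) ⊎-dec (x ≟ v))

ContractsVia : ∀ {k} → Trigraph (suc k) → Trigraph k →
  Fin (suc k) → Fin (suc k) → (Fin (suc k) → Fin k) → Set
ContractsVia T T' u v q = u ≢ v × q u ≡ q v
  × (∀ x y → Outside u v x → q x ≡ q y → x ≡ y)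
  × (∀ x y → Outside u v x → Outside u v y → E T' (q x) (q y) ≡ E T x y)
  × (∀ x → Outside u v x → E T' (q u) (q x) ≡ comb (E T u x) (E T v x))

contractsVia? : ∀ {k} (T : Trigraph (suc k)) (T' : Trigraph k) u v q →
  Dec (ContractsVia T T' u v q)
contractsVia? T T' u v q = ¬? (u ≟ v) ×-dec (q u ≟ q v)
  ×-dec (all? λ x → all? λ y → outside? u v x →-dec ((q x ≟ q y) →-dec (x ≟ y)))
  ×-dec (all? λ x → all? λ y → outside? u v x →-dec (outside? u v y →-dec
           (E T' (q x) (q y) ≟ᶜ E T x y)))
  ×-dec (all? λ x → outside? u v x →-dec (E T' (q u) (q x) ≟ᶜ comb (E T u x) (E T v x)))

contract : ∀ {d k} (T : Trigraph (suc k)) (T' : Trigraph k) u v q →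
  {_ : True (redBounded? d T)} → {_ : True (contractsVia? T T' u v q)} →
  Seq d k T' → Seq d (suc k) T
contract T T' u v q {b} {c} = step T T' (toWitness b) (u , v , q , toWitness c)

seq-redBounded : ∀ {d k T} → Seq d k T → RedBounded d T
seq-redBounded (last _ b)       = b
seq-redBounded (step _ _ b _ _) = b

term≤sum-tabulate : ∀ {k} (g : Fin k → ℕ) a → g a ≤ sum (tabulate g)
term≤sum-tabulate g zero    = m≤m+n _ _
term≤sum-tabulate g (suc a) = ≤-trans (term≤sum-tabulate (g ∘ suc) a) (m≤n+m _ (g zero))

twoTerms≤sum-tabulate : ∀ {k} (g : Fin k → ℕ) {a b} → a ≢ b → g a + g b ≤ sum (tabulate g)
twoTerms≤sum-tabulate g {zero}  {zero}  a≢b = ⊥-elim (a≢b refl)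
twoTerms≤sum-tabulate g {zero}  {suc b} _   = +-monoʳ-≤ (g zero) (term≤sum-tabulate (g ∘ suc) b)
twoTerms≤sum-tabulate g {suc a} {zero}  _   =
  subst (_≤ sum (tabulate g)) (+-comm (g zero) (g (suc a)))
    (+-monoʳ-≤ (g zero) (term≤sum-tabulate (g ∘ suc) a))
twoTerms≤sum-tabulate g {suc a} {suc b} a≢b =
  ≤-trans (twoTerms≤sum-tabulate (g ∘ suc) (a≢b ∘ cong suc)) (m≤n+m _ (g zero))

redDeg-tabulate : ∀ {k} (T : Trigraph k) x → redDeg T x ≡ sum (tabulate (isRed ∘ E T x))
redDeg-tabulate T x = cong sum (map-tabulate id (isRed ∘ E T x))

2≤redDeg : ∀ {k} (T : Trigraph k) {x y z} → y ≢ z →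
  E T x y ≡ red → E T x z ≡ red → 2 ≤ redDeg T x
2≤redDeg T {x} {y} {z} y≢z xy-red xz-red =
  subst (2 ≤_) (≡-sym (redDeg-tabulate T x))
    (subst₂ (λ c c' → isRed c + isRed c' ≤ sum (tabulate (isRed ∘ E T x))) xy-red xz-red
      (twoTerms≤sum-tabulate (isRed ∘ E T x) y≢z))

Distinguishes : ∀ {n} → (Fin n → Fin n → Set) → Fin n → Fin n → Fin n → Set
Distinguishes A u v x = (A u x × ¬ A v x) ⊎ (¬ A u x × A v x)

TwiceDistinguished : ∀ {n} → (Fin n → Fin n → Set) → Set
TwiceDistinguished {n} A = ∀ (u v : Fin n) → u ≢ v → Σ (Fin n) λ x → Σ (Fin n) λ y →
  x ≢ y × Outside u v x × Outside u v y × Distinguishes A u v x × Distinguishes A u v y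

twiceDistinguished? : ∀ {n} {A : Fin n → Fin n → Set} → (∀ u v → Dec (A u v)) →
  Dec (TwiceDistinguished A)
twiceDistinguished? {A = A} A? = all? λ u → all? λ v → ¬? (u ≟ v) →-dec
  (any? λ x → any? λ y → ¬? (x ≟ y) ×-dec outside? u v x ×-dec outside? u v y
     ×-dec distinguishes? u v x ×-dec distinguishes? u v y)
  where
  distinguishes? : ∀ u v x → Dec (Distinguishes A u v x)
  distinguishes? u v x = (A? u x ×-dec ¬? (A? v x)) ⊎-dec (¬? (A? u x) ×-dec A? v x)

contraction-reddens : ∀ {k} {T : Trigraph (suc k)} {T' : Trigraph k}
  {A : Fin (suc k) → Fin (suc k) → Set} {u v q} →
  Represents T A → ContractsVia T T' u v q →
  ∀ {x} → Outside u v x → Distinguishes A u v x → E T' (q u) (q x) ≡ red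
contraction-reddens {T = T} {A = A} {u} {v} rep (_ , _ , _ , _ , merge) {x} out dist =
  trans (merge x out) (comb-red dist)
  where
  edge : ∀ {y} → A y x → E T y x ≡ black
  edge = represents-edge {T = T} {A} rep
  nonEdge : ∀ {y} → ¬ A y x → E T y x ≡ none
  nonEdge = represents-nonEdge {T = T} {A} rep
  comb-red : Distinguishes A u v x → comb (E T u x) (E T v x) ≡ red
  comb-red (inj₁ (ux , ¬vx)) = cong₂ comb (edge ux) (nonEdge ¬vx)
  comb-red (inj₂ (¬ux , vx)) = cong₂ comb (nonEdge ¬ux) (edge vx)

twiceDistinguished⇒2≤ : ∀ {k d} {T : Trigraph (suc (suc k))}
  {A : Fin (suc (suc k)) → Fin (suc (suc k)) → Set} →
  Represents T A → TwiceDistinguished A → Seq d (suc (suc k)) T → 2 ≤ d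
twiceDistinguished⇒2≤ {T = T} {A} rep twice
  (step _ T' _ (u , v , q , c@(u≢v , _ , q-inj , _)) s)
  with twice u v u≢v
... | x , y , x≢y , out-x , out-y , dist-x , dist-y =
  ≤-trans (2≤redDeg T' (x≢y ∘ q-inj x y out-x) (reddens out-x dist-x) (reddens out-y dist-y))
          (seq-redBounded s (q u))
  where
  reddens : ∀ {z} → Outside u v z → Distinguishes A u v z → E T' (q u) (q z) ≡ red
  reddens = contraction-reddens {T = T} {T'} {A} rep c

cliqueColour : ∀ {k} → Fin k → Fin k → Col
cliqueColour zero    zero    = none
cliqueColour zero    (suc _) = black
cliqueColour (suc _) zero    = black
cliqueColour (suc x) (suc y) = cliqueColour x y

cliqueColour-sym : ∀ {k} (x y : Fin k) → cliqueColour x y ≡ cliqueColour y x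
cliqueColour-sym zero    zero    = refl
cliqueColour-sym zero    (suc _) = refl
cliqueColour-sym (suc _) zero    = refl
cliqueColour-sym (suc x) (suc y) = cliqueColour-sym x y

cliqueColour-irrefl : ∀ {k} (x : Fin k) → cliqueColour x x ≡ none
cliqueColour-irrefl zero    = refl
cliqueColour-irrefl (suc x) = cliqueColour-irrefl x

clique : ∀ k → Trigraph k
clique k = record { E = cliqueColour ; sym = cliqueColour-sym ; irr = cliqueColour-irrefl }

cliqueColour-notRed : ∀ {k} (x y : Fin k) → isRed (cliqueColour x y) ≡ 0
cliqueColour-notRed zero    zero    = refl
cliqueColour-notRed zero    (suc _) = refl
cliqueColour-notRed (suc _) zero    = refl
cliqueColour-notRed (suc x) (suc y) = cliqueColour-notRed x y

sum-tabulate-zeros : ∀ {m} (g : Fin m → ℕ) → (∀ i → g i ≡ 0) → sum (tabulate g) ≡ 0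
sum-tabulate-zeros {zero}  g _     = refl
sum-tabulate-zeros {suc m} g zeros =
  cong₂ _+_ (zeros zero) (sum-tabulate-zeros (g ∘ suc) (zeros ∘ suc))

clique-redDeg : ∀ k x → redDeg (clique k) x ≡ 0
clique-redDeg k x =
  trans (redDeg-tabulate (clique k) x) (sum-tabulate-zeros _ (cliqueColour-notRed x))

clique-redBounded : ∀ d k → RedBounded d (clique k)
clique-redBounded d k x = subst (_≤ d) (≡-sym (clique-redDeg k x)) z≤n

mergeFirstTwo : ∀ {k} → Fin (suc (suc k)) → Fin (suc k)
mergeFirstTwo zero    = zero
mergeFirstTwo (suc x) = x

clique-contracts : ∀ k →
  ContractsVia (clique (suc (suc k))) (clique (suc k)) zero (suc zero) mergeFirstTwo
clique-contracts k = (λ ()) , refl , injective , preserves , merges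
  where
  injective : ∀ x y → Outside zero (suc zero) x → mergeFirstTwo x ≡ mergeFirstTwo y → x ≡ y
  injective zero          _             out _  = ⊥-elim (out (inj₁ refl))
  injective (suc zero)    _             out _  = ⊥-elim (out (inj₂ refl))
  injective (suc (suc x)) (suc (suc y)) _   eq = cong suc eq
  injective (suc (suc x)) zero          _   ()
  injective (suc (suc x)) (suc zero)    _   ()
  preserves : ∀ x y → Outside zero (suc zero) x → Outside zero (suc zero) y →
    cliqueColour (mergeFirstTwo x) (mergeFirstTwo y) ≡ cliqueColour x y
  preserves zero          _             out _   = ⊥-elim (out (inj₁ refl))
  preserves (suc zero)    _             out _   = ⊥-elim (out (inj₂ refl))
  preserves _             zero          _   out = ⊥-elim (out (inj₁ refl))
  preserves _             (suc zero)    _   out = ⊥-elim (out (inj₂ refl))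
  preserves (suc (suc x)) (suc (suc y)) _   _   = refl
  merges : ∀ x → Outside zero (suc zero) x →
    cliqueColour zero (mergeFirstTwo x) ≡ comb (cliqueColour zero x) (cliqueColour (suc zero) x)
  merges zero          out = ⊥-elim (out (inj₁ refl))
  merges (suc zero)    out = ⊥-elim (out (inj₂ refl))
  merges (suc (suc x)) _   = refl

clique-seq : ∀ k → Seq 0 (suc k) (clique (suc k))
clique-seq zero    = last (clique 1) (clique-redBounded _ 1)
clique-seq (suc k) = step (clique (suc (suc k))) (clique (suc k))
  (clique-redBounded 0 (suc (suc k)))
  (zero , suc zero , mergeFirstTwo , clique-contracts k) (clique-seq k)

module _ (M : PlaneMap) where

  Adj-sym : ∀ {u v} → Adj M u v → Adj M v u
  Adj-sym (x , x-u , αx-v) = α M x , αx-v , trans (cong (vert M) (α-invol M x)) x-u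

  DualAdj-sym : ∀ {a b} → DualAdj M a b → DualAdj M b a
  DualAdj-sym (x , x-a , αx-b) = α M x , αx-b , trans (cong (face M) (α-invol M x)) x-a

  Adj-irrefl : GraphSimple M → ∀ u → ¬ Adj M u u
  Adj-irrefl (noLoop , _) u (x , x-u , αx-u) = noLoop x (trans αx-u (≡-sym x-u))

  DualAdj-irrefl : DualSimple M → ∀ a → ¬ DualAdj M a a
  DualAdj-irrefl (noLoop , _) a (x , x-a , αx-a) = noLoop x (trans αx-a (≡-sym x-a))

  adj? : ∀ u v → Dec (Adj M u v)
  adj? u v = any? λ x → (vert M x ≟ u) ×-dec (vert M (α M x) ≟ v)

  dualAdj? : ∀ a b → Dec (DualAdj M a b)
  dualAdj? a b = any? λ x → (face M x ≟ a) ×-dec (face M (α M x) ≟ b)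

  graphSimple? : Dec (GraphSimple M)
  graphSimple? = (all? λ x → ¬? (vert M (α M x) ≟ vert M x))
    ×-dec (all? λ x → all? λ y → (vert M x ≟ vert M y) →-dec
             ((vert M (α M x) ≟ vert M (α M y)) →-dec (x ≟ y)))

  dualSimple? : Dec (DualSimple M)
  dualSimple? = (all? λ x → ¬? (face M (α M x) ≟ face M x))
    ×-dec (all? λ x → all? λ y → (face M x ≟ face M y) →-dec
             ((face M (α M x) ≟ face M (α M y)) →-dec (x ≟ y)))

  graph : GraphSimple M → Trigraph (n M)
  graph simple = simpleTrigraph adj? Adj-sym (Adj-irrefl simple)

  dual : DualSimple M → Trigraph (f M)
  dual simple = simpleTrigraph dualAdj? DualAdj-sym (DualAdj-irrefl simple)

iter-invariant : ∀ {A B : Set} (f : A → A) (g : A → B) →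
  (∀ x → g (f x) ≡ g x) → ∀ k x → g (iter f k x) ≡ g x
iter-invariant f g inv zero    x = refl
iter-invariant f g inv (suc k) x = trans (inv (iter f k x)) (iter-invariant f g inv k x)

labels-orbits : ∀ {A B : Set} (f : A → A) (g : A → B) (b : ℕ) →
  (∀ x → g (f x) ≡ g x) →
  (∀ x y → g x ≡ g y → ∃ λ (k : Fin b) → iter f (toℕ k) x ≡ y) →
  ∀ x y → (g x ≡ g y → SameOrbit f x y) × (SameOrbit f x y → g x ≡ g y)
labels-orbits f g b inv bounded x y =
  (λ gx≡gy → let k , fᵏx≡y = bounded x y gx≡gy in toℕ k , fᵏx≡y) ,
  λ { (k , fᵏx≡y) → trans (≡-sym (iter-invariant f g inv k x)) (cong g fᵏx≡y) }

labels-orbits? : ∀ {m d} (f : Fin d → Fin d) (g : Fin d → Fin m) (b : ℕ) →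
  Dec (∀ x y → g x ≡ g y → ∃ λ (k : Fin b) → iter f (toℕ k) x ≡ y)
labels-orbits? f g b = all? λ x → all? λ y → (g x ≟ g y) →-dec any? λ k → iter f (toℕ k) x ≟ y

module _ {A : Set} (σ α : A → A) where

  run : List Bool → A → A
  run []          x = x
  run (true  ∷ w) x = σ (run w x)
  run (false ∷ w) x = α (run w x)

  Reach-run : ∀ w x → Reach σ α x (run w x)
  Reach-run []          x = here
  Reach-run (true  ∷ w) x = viaσ (Reach-run w x)
  Reach-run (false ∷ w) x = viaα (Reach-run w x)

wordsUpTo : ℕ → List (List Bool)
wordsUpTo zero    = [] ∷ []
wordsUpTo (suc L) = [] ∷ map (true ∷_) (wordsUpTo L) ++ map (false ∷_) (wordsUpTo L)

connected? : ∀ {d} (σ α : Fin d → Fin d) (L : ℕ) →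
  Dec (∀ x y → Any.Any (λ w → run σ α w x ≡ y) (wordsUpTo L))
connected? σ α L = all? λ x → all? λ y → Any.any? (λ w → run σ α w x ≟ y) (wordsUpTo L)

connected-by-words : ∀ {d} {σ α : Fin d → Fin d} L →
  (∀ x y → Any.Any (λ w → run σ α w x ≡ y) (wordsUpTo L)) → ∀ x y → Reach σ α x y
connected-by-words {σ = σ} {α} _ words x y with Any.satisfied (words x y)
... | w , wx≡y = subst (Reach σ α x) wx≡y (Reach-run σ α w x)

-- The triangular prism: darts 2i and 2i+1 form the edges 01, 12, 20, 34, 45, 53, 03, 14, 25;
-- faces 0 and 4 are the two triangles, faces 1, 2, 3 the quadrilaterals.
prism : PlaneMap
prism = record
  { d = 18 ; n = 6 ; f = 5 ; α = αP ; σ = σP ; σ⁻¹ = σ⁻¹P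
  ; α-invol   = from-yes (all? λ x → αP (αP x) ≟ x)
  ; α-nofix   = from-yes (all? λ x → ¬? (αP x ≟ x))
  ; σ-left    = from-yes (all? λ x → σ⁻¹P (σP x) ≟ x)
  ; σ-right   = from-yes (all? λ x → σP (σ⁻¹P x) ≟ x)
  ; vert      = vertP
  ; vert-surj = from-yes (all? λ v → any? λ x → vertP x ≟ v)
  ; vert-orb  = labels-orbits σP vertP 3 (from-yes (all? λ x → vertP (σP x) ≟ vertP x))
                  (from-yes (labels-orbits? σP vertP 3))
  ; face      = faceP
  ; face-surj = from-yes (all? λ a → any? λ x → faceP x ≟ a)
  ; face-orb  = labels-orbits (σP ∘ αP) faceP 4
                  (from-yes (all? λ x → faceP (σP (αP x)) ≟ faceP x))
                  (from-yes (labels-orbits? (σP ∘ αP) faceP 4))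
  ; connected = connected-by-words 6 (from-yes (connected? σP αP 6))
  ; euler     = refl
  }
  where
  αP σP σ⁻¹P : Fin 18 → Fin 18
  αP = lookup (# 1 ∷ # 0 ∷ # 3 ∷ # 2 ∷ # 5 ∷ # 4 ∷ # 7 ∷ # 6 ∷ # 9 ∷ # 8
             ∷ # 11 ∷ # 10 ∷ # 13 ∷ # 12 ∷ # 15 ∷ # 14 ∷ # 17 ∷ # 16 ∷ [])
  σP = lookup (# 12 ∷ # 2 ∷ # 14 ∷ # 4 ∷ # 16 ∷ # 0 ∷ # 11 ∷ # 15 ∷ # 7 ∷ # 17
             ∷ # 9 ∷ # 13 ∷ # 5 ∷ # 6 ∷ # 1 ∷ # 8 ∷ # 3 ∷ # 10 ∷ [])
  σ⁻¹P = lookup (# 5 ∷ # 14 ∷ # 1 ∷ # 16 ∷ # 3 ∷ # 12 ∷ # 13 ∷ # 8 ∷ # 15 ∷ # 10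
               ∷ # 17 ∷ # 6 ∷ # 0 ∷ # 11 ∷ # 2 ∷ # 7 ∷ # 4 ∷ # 9 ∷ [])
  vertP : Fin 18 → Fin 6
  vertP = lookup (# 0 ∷ # 1 ∷ # 1 ∷ # 2 ∷ # 2 ∷ # 0 ∷ # 3 ∷ # 4 ∷ # 4 ∷ # 5
                ∷ # 5 ∷ # 3 ∷ # 0 ∷ # 3 ∷ # 1 ∷ # 4 ∷ # 2 ∷ # 5 ∷ [])
  faceP : Fin 18 → Fin 5
  faceP = lookup (# 0 ∷ # 1 ∷ # 0 ∷ # 2 ∷ # 0 ∷ # 3 ∷ # 1 ∷ # 4 ∷ # 2 ∷ # 4
                ∷ # 3 ∷ # 4 ∷ # 1 ∷ # 3 ∷ # 2 ∷ # 1 ∷ # 3 ∷ # 2 ∷ [])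

prism-simple : GraphSimple prism
prism-simple = from-yes (graphSimple? prism)

prism-dualSimple : DualSimple prism
prism-dualSimple = from-yes (dualSimple? prism)

prism-twiceDistinguished : TwiceDistinguished (Adj prism)
prism-twiceDistinguished = from-yes (twiceDistinguished? (adj? prism))

prism-seq : Seq 2 6 (graph prism prism-simple)
prism-seq =
  contract (graph prism prism-simple) T₅ (# 0) (# 1)
    (lookup (# 0 ∷ # 0 ∷ # 1 ∷ # 2 ∷ # 3 ∷ # 4 ∷ []))
  (contract T₅ T₄ (# 0) (# 4) (lookup (# 0 ∷ # 1 ∷ # 2 ∷ # 3 ∷ # 0 ∷ []))
  (contract T₄ T₃ (# 0) (# 1) (lookup (# 0 ∷ # 0 ∷ # 1 ∷ # 2 ∷ []))
  (contract T₃ T₂ (# 0) (# 1) (lookup (# 0 ∷ # 0 ∷ # 1 ∷ []))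
  (contract T₂ (clique 1) (# 0) (# 1) (lookup (# 0 ∷ # 0 ∷ []))
  (last (clique 1) (clique-redBounded _ 1))))))
  where
  T₅ : Trigraph 5
  T₅ = fromTable ((none ∷ black ∷ red ∷ red ∷ none ∷ [])
                ∷ (black ∷ none ∷ none ∷ none ∷ black ∷ [])
                ∷ (red ∷ none ∷ none ∷ black ∷ black ∷ [])
                ∷ (red ∷ none ∷ black ∷ none ∷ black ∷ [])
                ∷ (none ∷ black ∷ black ∷ black ∷ none ∷ []) ∷ [])
  T₄ : Trigraph 4
  T₄ = fromTable ((none ∷ black ∷ red ∷ red ∷ [])
                ∷ (black ∷ none ∷ none ∷ none ∷ [])
                ∷ (red ∷ none ∷ none ∷ black ∷ [])
                ∷ (red ∷ none ∷ black ∷ none ∷ []) ∷ [])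
  T₃ : Trigraph 3
  T₃ = fromTable ((none ∷ red ∷ red ∷ [])
                ∷ (red ∷ none ∷ black ∷ [])
                ∷ (red ∷ black ∷ none ∷ []) ∷ [])
  T₂ : Trigraph 2
  T₂ = fromTable ((none ∷ red ∷ []) ∷ (red ∷ none ∷ []) ∷ [])

-- Faces 0 and 4, the two triangles, are the non-adjacent twins of K₅ − e.
dual-seq : Seq 0 5 (dual prism prism-dualSimple)
dual-seq = contract (dual prism prism-dualSimple) (clique 4) (# 0) (# 4)
  (lookup (# 0 ∷ # 1 ∷ # 2 ∷ # 3 ∷ # 0 ∷ [])) (clique-seq 3)

theorem1p3 : Σ PlaneMap λ M → GraphSimple M × DualSimple M
    × Σ ℕ λ t → Σ ℕ λ t* →
      TwinWidth (n M) (Adj M) t × TwinWidth (f M) (DualAdj M) t* × t ≢ t*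
theorem1p3 = prism , prism-simple , prism-dualSimple , 2 , 0
  , ((graph prism prism-simple , represents-graph , prism-seq)
    , λ { _ (_ , rep , s) → twiceDistinguished⇒2≤ rep prism-twiceDistinguished s })
  , ((dual prism prism-dualSimple , represents-dual , dual-seq) , λ _ _ → z≤n)
  , λ ()
  where
  represents-graph : Represents (graph prism prism-simple) (Adj prism)
  represents-graph = simpleTrigraph-represents (adj? prism) (Adj-sym prism)
    (Adj-irrefl prism prism-simple)
  represents-dual : Represents (dual prism prism-dualSimple) (DualAdj prism)
  represents-dual = simpleTrigraph-represents (dualAdj? prism) (DualAdj-sym prism)
    (DualAdj-irrefl prism prism-dualSimple)
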